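{- Let $G$ be a connected simple graph containing a vertex $a$ with $d_G(a)\geq 2$, fix any execution of Algorithm $\text{tree}(G)$, and let $r$ be the rank function associated with this execution (as defined in the context). Then each vertex $u$ of $G$ has at most one neighbor $v$ in $G$ with $r(u)<r(v)$.
   Context: All graphs are finite, undirected and simple. For a graph $H$ and $u\in V(H)$, $d_H(u)$ is the number of neighbors of $u$ in $H$. For a tree $T$ that is a subgraph of $G$ and $u\in V(T)$, let $V_T(u)$ be the set of vertices $v\in V(G)\setminus V(T)$ with $uv\in E(G)$, and $E_T(u)=\{uv:v\in V_T(u)\}$; if $|V_T(u)|=1$, let $v_T(u)$ be its unique element. $T\cup E_T(u)$ is the tree obtained by adding the vertices $V_T(u)$ and edges $E_T(u)$ ("expanding $T$ at $u$"). $W_2(T)$ is the set of $u\in V(T)$ with $|V_T(u)|\geq 2$; $W_1(T)$ is the set of $u\in V(T)$ with $|V_T(u)|=1$ and $|V_{T\cup E_T(u)}(v_T(u))|\geq 2$; $W_0(T)$ is the set of $u\in V(T)$ with $|V_T(u)|=1$ and $|V_{T\cup E_T(u)}(v_T(u))|\leq 1$. Algorithm $\text{tree}(G)$: start with $T=\{a\}$; while $V(T)\neq V(G)$: if $W_2(T)\neq\varnothing$ let $u$ be an arbitrary vertex of $W_2(T)$; else if $W_1(T)\neq\varnothing$ let $u$ be an arbitrary vertex of $W_1(T)$; else let $u$ be the vertex of $W_0(T)$ that joined $V(T)$ most recently; then set $T:=T\cup E_T(u)$. Return $T$. For a fixed execution, let $T$ be the returned spanning tree, rooted at $a$, and for $v\neq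 a$ let $p(v)$ be the parent of $v$ in $T$. For each vertex $u$ at which the algorithm expands the tree, let $T_u$ be the current tree immediately before that expansion (so $u=p(v)$ iff $v\in V_{T_u}(u)$). Define ranks $r:V(G)\to\mathbb{Z}$ by $r(a)=1$ and, for each edge $uv$ of $T$ with $u=p(v)$: $r(v)=r(u)$ if $u\in W_2(T_u)$, and $r(v)=1+\max_{w\in V(T_u)} r(w)$ otherwise. -}

module Defs where

open import Data.Nat using (ℕ; zero; suc; _+_; _≤_; _<_; _⊔_; _≤?_)
open import Data.Nat.ListAction using (sum)
open import Data.Sum using (_⊎_)
open import Data.Bool using (Bool; true; false; _∧_; _∨_; not; if_then_else_)
open import Data.Fin using (Fin; _≟_)
open import Data.List using (List; map; foldr; allFin)
open import Data.Product using (Σ; _×_; _,_; ∃)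
open import Relation.Nullary using (¬_; does)
open import Relation.Binary.PropositionalEquality using (_≡_)

record Graph (n : ℕ) : Set where
  field
    adj    : Fin n → Fin n → Bool
    sym    : ∀ u v → adj u v ≡ adj v u
    irrefl : ∀ u → adj u u ≡ false
open Graph public

countB : ∀ {n} → (Fin n → Bool) → ℕ
countB {n} p = sum (map (λ v → if p v then 1 else 0) (allFin n))

degree : ∀ {n} → Graph n → Fin n → ℕ
degree G u = countB (adj G u)

data Walk {n} (G : Graph n) : Fin n → Fin n → Set where
  here : ∀ {u} → Walk G u u
  there : ∀ {u v w} → adj G u v ≡ true → Walk G v w → Walk G u w

Connected : ∀ {n} → Graph n → Set
Connected G = ∀ u v → Walk G u v

-- Trees built by the algorithm are represented by their vertex sets
-- (Fin n → Bool); the edges are irrelevant for the quantities below.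

VSet : ℕ → Set
VSet n = Fin n → Bool

outN : ∀ {n} → Graph n → VSet n → Fin n → ℕ
outN G T u = countB (λ v → adj G u v ∧ not (T v))

expand : ∀ {n} → Graph n → VSet n → Fin n → VSet n
expand G T u w = T w ∨ (adj G u w ∧ not (T w))

W2 : ∀ {n} → Graph n → VSet n → Fin n → Set
W2 G T u = T u ≡ true × 2 ≤ outN G T u

-- W_1(T)  (v is then the unique element v_T(u) of V_T(u))
W1 : ∀ {n} → Graph n → VSet n → Fin n → Set
W1 G T u = T u ≡ true × outN G T u ≡ 1 ×
  Σ (Fin _) (λ v → adj G u v ≡ true × T v ≡ false × 2 ≤ outN G (expand G T u) v)

W0 : ∀ {n} → Graph n → VSet n → Fin n → Set
W0 G T u = T u ≡ true × outN G T u ≡ 1 ×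
  Σ (Fin _) (λ v → adj G u v ≡ true × T v ≡ false × outN G (expand G T u) v ≤ 1)

record State (n : ℕ) : Set where
  constructor st
  field
    tree  : VSet n
    jtime : Fin n → ℕ     -- index of the expansion at which a vertex joined V(T)
    rank  : Fin n → ℕ     -- r, on the vertices of T
    steps : ℕ
open State public

initial : ∀ {n} → Fin n → State n
initial a = st (λ w → does (w ≟ a)) (λ _ → 0) (λ _ → 1) 0

maxRank : ∀ {n} → State n → ℕ
maxRank {n} s = foldr _⊔_ 0 (map (λ w → if tree s w then rank s w else 0) (allFin n))

Choosable : ∀ {n} → Graph n → State n → Fin n → Set
Choosable G s u =
    W2 G T u
  ⊎ ((¬ ∃ (W2 G T)) × W1 G T u)
  ⊎ ((¬ ∃ (W2 G T)) × (¬ ∃ (W1 G T)) × W0 G T u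
       × (∀ w → W0 G T w → jtime s w ≤ jtime s u))
  where
    T = tree s

expandState : ∀ {n} → Graph n → State n → Fin n → State n
expandState G s u = st T' jt' rk' (suc (steps s))
  where
    T   = tree s
    new : Fin _ → Bool
    new w = adj G u w ∧ not (T w)
    T'  = expand G T u
    jt' = λ w → if new w then suc (steps s) else jtime s w
    r   : ℕ
    r   = if does (2 ≤? outN G T u) then rank s u else suc (maxRank s)
    rk' = λ w → if new w then r else rank s w

data Run {n} (G : Graph n) (a : Fin n) : State n → Set where
  start : Run G a (initial a)
  step  : ∀ {s} u → Run G a s → (∃ λ w → tree s w ≡ false)
        → Choosable G s u → Run G a (expandState G s u)

-- a complete execution: the loop has terminated, V(T) = V(G)
Execution : ∀ {n} → Graph n → Fin n → State n → Set
Execution G a s = Run G a s × (∀ w → tree s w ≡ true)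

{-# OPTIONS --safe #-}
module Submission where

open import Defs
open import Data.Nat using (ℕ; _≤_; _<_; suc; _⊔_; _≤?_; _<?_; z≤n; s≤s)
open import Data.Nat.Properties
open import Data.Nat.ListAction using (sum)
open import Data.Bool using (Bool; true; false; _∧_; not; if_then_else_)
open import Data.Fin using (Fin)
open import Data.List using (List; []; _∷_; map; foldr; allFin)
open import Data.List.Relation.Unary.Any using (here; there)
open import Data.List.Membership.Propositional using (_∈_)
open import Data.List.Membership.Propositional.Properties using (∈-allFin)
open import Data.Product using (_×_; _,_; ∃)
open import Data.Sum using (_⊎_; inj₁; inj₂)
open import Data.Empty using (⊥-elim)
open import Relation.Nullary using (¬_; does; yes; no)
open import Relation.Nullary.Decidable using (dec-true)
open import Relation.Binary.PropositionalEquality as ≡ using (_≡_; refl; subst)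
import Data.Fin as Fin

-- Write h(v) for r(v) when v is already in the tree and for the current maximal rank otherwise.
-- Along any execution two facts are preserved: every vertex of W₂(T) has maximal rank, and every
-- vertex u of T has at most one neighbour v with r(u) < h(v). Expanding at a W₂-vertex hands out
-- the current maximal rank, so neither the maximum nor h changes. Expanding at a W₁- or
-- W₀-vertex happens only when W₂(T) is empty, so each u ∈ T has at most one neighbour outside T,
-- and that is the only neighbour whose h can newly exceed r(u). At the end h = r.

≤-foldr-⊔ : ∀ {A : Set} (f : A → ℕ) {x} (xs : List A) → x ∈ xs → f x ≤ foldr _⊔_ 0 (map f xs)
≤-foldr-⊔ f (y ∷ ys) (here refl) = m≤m⊔n (f y) _
≤-foldr-⊔ f (y ∷ ys) (there x∈ys) = ≤-trans (≤-foldr-⊔ f ys x∈ys) (m≤n⊔m (f y) _)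

foldr-⊔-≤ : ∀ {A : Set} (f : A → ℕ) {m} (xs : List A) → (∀ x → f x ≤ m) → foldr _⊔_ 0 (map f xs) ≤ m
foldr-⊔-≤ f []       f≤m = z≤n
foldr-⊔-≤ f (y ∷ ys) f≤m = ⊔-lub (f≤m y) (foldr-⊔-≤ f ys f≤m)

count : ∀ {A : Set} → (A → Bool) → List A → ℕ
count p xs = sum (map (λ v → if p v then 1 else 0) xs)

count-mono : ∀ {A : Set} {p q : A → Bool} (xs : List A) →
             (∀ v → p v ≡ true → q v ≡ true) → count p xs ≤ count q xs
count-mono []       p⊆q = z≤n
count-mono {p = p} {q} (y ∷ ys) p⊆q with p y in py | q y in qy
... | true  | true  = s≤s (count-mono ys p⊆q)
... | true  | false with () ← subst (_≡ true) qy (p⊆q y py)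
... | false | true  = m≤n⇒m≤1+n (count-mono ys p⊆q)
... | false | false = count-mono ys p⊆q

1≤count : ∀ {A : Set} (p : A → Bool) {v} (xs : List A) → v ∈ xs → p v ≡ true → 1 ≤ count p xs
1≤count p (y ∷ ys) (here refl) pv rewrite pv = s≤s z≤n
1≤count p (y ∷ ys) (there v∈ys) pv = ≤-trans (1≤count p ys v∈ys pv) (m≤n+m _ _)

2≤count : ∀ {A : Set} (p : A → Bool) {v v'} (xs : List A) → v ∈ xs → v' ∈ xs → ¬ v ≡ v' →
          p v ≡ true → p v' ≡ true → 2 ≤ count p xs
2≤count p (y ∷ ys) (here refl) (here refl)  v≢v' pv pv' = ⊥-elim (v≢v' refl)
2≤count p (y ∷ ys) (here refl) (there v'∈) v≢v' pv pv' rewrite pv  = s≤s (1≤count p ys v'∈ pv')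
2≤count p (y ∷ ys) (there v∈)  (here refl) v≢v' pv pv' rewrite pv' = s≤s (1≤count p ys v∈ pv)
2≤count p (y ∷ ys) (there v∈)  (there v'∈) v≢v' pv pv' =
  ≤-trans (2≤count p ys v∈ v'∈ v≢v' pv pv') (m≤n+m _ _)

countB≤1⇒unique : ∀ {n} (p : Fin n → Bool) {v v'} → countB p ≤ 1 → p v ≡ true → p v' ≡ true → v ≡ v'
countB≤1⇒unique {n} p {v} {v'} ≤1 pv pv' with v Fin.≟ v'
... | yes v≡v' = v≡v'
... | no  v≢v' = ⊥-elim (<-irrefl refl
                   (≤-trans (2≤count p (allFin n) (∈-allFin v) (∈-allFin v') v≢v' pv pv') ≤1))

≡true⊎≡false : ∀ b → b ≡ true ⊎ b ≡ false
≡true⊎≡false true  = inj₁ refl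
≡true⊎≡false false = inj₂ refl

∧-not-antitone : ∀ b {c c'} → (c ≡ true → c' ≡ true) → b ∧ not c' ≡ true → b ∧ not c ≡ true
∧-not-antitone true  {false}        _    _  = refl
∧-not-antitone true  {true} {true}  _    ()
∧-not-antitone true  {true} {false} c⇒c' _ with () ← c⇒c' refl
∧-not-antitone false                _    ()

outsideNeighbour : ∀ {n} (G : Graph n) (T : VSet n) {u v} →
                   adj G u v ≡ true → T v ≡ false → adj G u v ∧ not (T v) ≡ true
outsideNeighbour G T uv Tv rewrite uv | Tv = refl

module _ {n} (s : State n) where

  rank≤maxRank : ∀ w → tree s w ≡ true → rank s w ≤ maxRank s
  rank≤maxRank w w∈T = subst (_≤ maxRank s) (inTree w∈T)
    (≤-foldr-⊔ (λ x → if tree s x then rank s x else 0) (allFin n) (∈-allFin w))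
    where
    inTree : tree s w ≡ true → (if tree s w then rank s w else 0) ≡ rank s w
    inTree eq rewrite eq = refl

  maxRank≤ : ∀ {m} → (∀ w → tree s w ≡ true → rank s w ≤ m) → maxRank s ≤ m
  maxRank≤ {m} bound = foldr-⊔-≤ _ (allFin n) bounded
    where
    bounded : ∀ w → (if tree s w then rank s w else 0) ≤ m
    bounded w with tree s w in w∈T
    ... | true  = bound w w∈T
    ... | false = z≤n

  rankOrMax : Fin n → ℕ
  rankOrMax v = if tree s v then rank s v else maxRank s

  rankOrMax≤maxRank : ∀ v → rankOrMax v ≤ maxRank s
  rankOrMax≤maxRank v with tree s v in v∈T
  ... | true  = rank≤maxRank v v∈T
  ... | false = ≤-refl

  maxRank≡rankOrMax-outside : ∀ {v} → tree s v ≡ false → maxRank s ≡ rankOrMax v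
  maxRank≡rankOrMax-outside v∉T rewrite v∉T = refl

  Rising : Fin n → Fin n → Set
  Rising u v = rank s u < rankOrMax v

record Invariant {n} (G : Graph n) (s : State n) : Set where
  field
    W₂-maxRank      : ∀ x → tree s x ≡ true → 2 ≤ outN G (tree s) x → maxRank s ≤ rank s x
    rising-unique   : ∀ u {v v'} → tree s u ≡ true → adj G u v ≡ true → adj G u v' ≡ true →
                      Rising s u v → Rising s u v' → v ≡ v'
open Invariant

invariant-initial : ∀ {n} (G : Graph n) (a : Fin n) → Invariant G (initial a)
invariant-initial G a = record
  { W₂-maxRank    = λ _ _ _ → maxRank≤1
  ; rising-unique = λ u {v} _ _ _ rising _ →
      ⊥-elim (<-irrefl refl (<-≤-trans rising (≤-trans (rankOrMax≤maxRank s v) maxRank≤1)))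
  }
  where
  s = initial a
  maxRank≤1 : maxRank s ≤ 1
  maxRank≤1 = maxRank≤ s (λ _ _ → ≤-refl)

module Expansion {n} (G : Graph n) (s : State n) (w : Fin n) where

  s' : State n
  s' = expandState G s w

  newRank : ℕ
  newRank = if does (2 ≤? outN G (tree s) w) then rank s w else suc (maxRank s)

  newRank-W₂ : 2 ≤ outN G (tree s) w → newRank ≡ rank s w
  newRank-W₂ two rewrite dec-true (2 ≤? outN G (tree s) w) two = refl

  newRank-single : outN G (tree s) w ≡ 1 → newRank ≡ suc (maxRank s)
  newRank-single one rewrite one = refl

  tree-old : ∀ {x} → tree s x ≡ true → tree s' x ≡ true
  tree-old x∈T rewrite x∈T = refl

  rank-old : ∀ {x} → tree s x ≡ true → rank s' x ≡ rank s x
  rank-old {x} x∈T rewrite x∈T with adj G w x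
  ... | true  = refl
  ... | false = refl

  rankOrMax-old : ∀ {x} → tree s x ≡ true → rankOrMax s' x ≡ rankOrMax s x
  rankOrMax-old x∈T rewrite tree-old x∈T | rank-old x∈T | x∈T = refl

  rank-joined : ∀ {x} → tree s' x ≡ true → tree s x ≡ false → rank s' x ≡ newRank
  rank-joined {x} x∈T' x∉T with tree s x | adj G w x
  rank-joined _  ()  | true  | _
  rank-joined _  _   | false | true  = refl
  rank-joined () _   | false | false

  maxRank'≤ : ∀ {m} → maxRank s ≤ m → newRank ≤ m → maxRank s' ≤ m
  maxRank'≤ {m} max≤m new≤m = maxRank≤ s' bound
    where
    bound : ∀ x → tree s' x ≡ true → rank s' x ≤ m
    bound x x∈T' with ≡true⊎≡false (tree s x)
    ... | inj₁ x∈T = subst (_≤ m) (≡.sym (rank-old x∈T)) (≤-trans (rank≤maxRank s x x∈T) max≤m)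
    ... | inj₂ x∉T = subst (_≤ m) (≡.sym (rank-joined x∈T' x∉T)) new≤m

  outN-antitone : ∀ x → outN G (tree s') x ≤ outN G (tree s) x
  outN-antitone x = count-mono (allFin n) (λ v → ∧-not-antitone (adj G x v) tree-old)

  rankOrMax-antitone : maxRank s' ≤ maxRank s → ∀ v → rankOrMax s' v ≤ rankOrMax s v
  rankOrMax-antitone max'≤max v with ≡true⊎≡false (tree s v)
  ... | inj₁ v∈T = ≤-reflexive (rankOrMax-old v∈T)
  ... | inj₂ v∉T = subst (rankOrMax s' v ≤_) (maxRank≡rankOrMax-outside s v∉T)
                     (≤-trans (rankOrMax≤maxRank s' v) max'≤max)

  module NewVertices (maxRank'≤newRank : maxRank s' ≤ newRank) where

    W₂-maxRank-joined : ∀ {x} → tree s' x ≡ true → tree s x ≡ false → maxRank s' ≤ rank s' x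
    W₂-maxRank-joined x∈T' x∉T rewrite rank-joined x∈T' x∉T = maxRank'≤newRank

    ¬rising-joined : ∀ {u} v → tree s' u ≡ true → tree s u ≡ false → ¬ Rising s' u v
    ¬rising-joined v u∈T' u∉T rising rewrite rank-joined u∈T' u∉T =
      <-irrefl refl (<-≤-trans rising (≤-trans (rankOrMax≤maxRank s' v) maxRank'≤newRank))

  rising-old : ∀ {u v} → tree s u ≡ true → Rising s' u v → rank s u < rankOrMax s' v
  rising-old u∈T = subst (_< _) (rank-old u∈T)

  invariant-W₂ : Invariant G s → tree s w ≡ true → 2 ≤ outN G (tree s) w → Invariant G s'
  invariant-W₂ I w∈T two = record { W₂-maxRank = W₂-maxRank' ; rising-unique = rising-unique' }
    where
    maxRank≤newRank : maxRank s ≤ newRank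
    maxRank≤newRank rewrite newRank-W₂ two = W₂-maxRank I w w∈T two

    newRank≤maxRank : newRank ≤ maxRank s
    newRank≤maxRank rewrite newRank-W₂ two = rank≤maxRank s w w∈T

    maxRank'≤maxRank : maxRank s' ≤ maxRank s
    maxRank'≤maxRank = maxRank'≤ ≤-refl newRank≤maxRank

    open NewVertices (maxRank'≤ maxRank≤newRank ≤-refl)

    W₂-maxRank' : ∀ x → tree s' x ≡ true → 2 ≤ outN G (tree s') x → maxRank s' ≤ rank s' x
    W₂-maxRank' x x∈T' two' with ≡true⊎≡false (tree s x)
    ... | inj₂ x∉T = W₂-maxRank-joined x∈T' x∉T
    ... | inj₁ x∈T = subst (maxRank s' ≤_) (≡.sym (rank-old x∈T))
      (≤-trans maxRank'≤maxRank (W₂-maxRank I x x∈T (≤-trans two' (outN-antitone x))))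

    rising-unique' : ∀ u {v v'} → tree s' u ≡ true → adj G u v ≡ true → adj G u v' ≡ true →
                     Rising s' u v → Rising s' u v' → v ≡ v'
    rising-unique' u {v} {v'} u∈T' uv uv' rv rv' with ≡true⊎≡false (tree s u)
    ... | inj₂ u∉T = ⊥-elim (¬rising-joined v u∈T' u∉T rv)
    ... | inj₁ u∈T = rising-unique I u u∈T uv uv' (lower rv) (lower rv')
      where
      lower : ∀ {x} → Rising s' u x → Rising s u x
      lower {x} r = <-≤-trans (rising-old u∈T r) (rankOrMax-antitone maxRank'≤maxRank x)

  invariant-single : Invariant G s → tree s w ≡ true → outN G (tree s) w ≡ 1 →
                     ¬ ∃ (W2 G (tree s)) → Invariant G s'
  invariant-single I w∈T one noW₂ = record { W₂-maxRank = W₂-maxRank' ; rising-unique = rising-unique' }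
    where
    maxRank≤newRank : maxRank s ≤ newRank
    maxRank≤newRank rewrite newRank-single one = n≤1+n _

    open NewVertices (maxRank'≤ maxRank≤newRank ≤-refl)

    W₂-maxRank' : ∀ x → tree s' x ≡ true → 2 ≤ outN G (tree s') x → maxRank s' ≤ rank s' x
    W₂-maxRank' x x∈T' two' with ≡true⊎≡false (tree s x)
    ... | inj₁ x∈T = ⊥-elim (noW₂ (x , x∈T , ≤-trans two' (outN-antitone x)))
    ... | inj₂ x∉T = W₂-maxRank-joined x∈T' x∉T

    rising-or-outside : ∀ {u v} → tree s u ≡ true → Rising s' u v →
                        Rising s u v ⊎ (tree s v ≡ false × maxRank s ≤ rank s u)
    rising-or-outside {u} {v} u∈T rv with ≡true⊎≡false (tree s v)
    ... | inj₁ v∈T = inj₁ (subst (rank s u <_) (rankOrMax-old v∈T) (rising-old u∈T rv))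
    ... | inj₂ v∉T with rank s u <? maxRank s
    ...   | yes u<max = inj₁ (subst (rank s u <_) (maxRank≡rankOrMax-outside s v∉T) u<max)
    ...   | no  u≮max = inj₂ (v∉T , ≮⇒≥ u≮max)

    rising-unique' : ∀ u {v v'} → tree s' u ≡ true → adj G u v ≡ true → adj G u v' ≡ true →
                     Rising s' u v → Rising s' u v' → v ≡ v'
    rising-unique' u {v} {v'} u∈T' uv uv' rv rv' with ≡true⊎≡false (tree s u)
    ... | inj₂ u∉T = ⊥-elim (¬rising-joined v u∈T' u∉T rv)
    ... | inj₁ u∈T with rising-or-outside u∈T rv | rising-or-outside u∈T rv'
    ...   | inj₁ r       | inj₁ r'        = rising-unique I u u∈T uv uv' r r'
    ...   | inj₁ r       | inj₂ (_ , max≤) = ⊥-elim (<⇒≱ (<-≤-trans r (rankOrMax≤maxRank s v)) max≤)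
    ...   | inj₂ (_ , max≤) | inj₁ r'      = ⊥-elim (<⇒≱ (<-≤-trans r' (rankOrMax≤maxRank s v')) max≤)
    ...   | inj₂ (v∉T , _) | inj₂ (v'∉T , _) =
      countB≤1⇒unique (λ x → adj G u x ∧ not (tree s x))
        (≮⇒≥ (λ two → noW₂ (u , u∈T , two)))
        (outsideNeighbour G (tree s) uv v∉T) (outsideNeighbour G (tree s) uv' v'∉T)

invariant-step : ∀ {n} (G : Graph n) {s : State n} {w} → Invariant G s → Choosable G s w →
                 Invariant G (expandState G s w)
invariant-step G {s} {w} I (inj₁ (w∈T , two)) =
  Expansion.invariant-W₂ G s w I w∈T two
invariant-step G {s} {w} I (inj₂ (inj₁ (noW₂ , w∈T , one , _))) =
  Expansion.invariant-single G s w I w∈T one noW₂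
invariant-step G {s} {w} I (inj₂ (inj₂ (noW₂ , _ , (w∈T , one , _) , _))) =
  Expansion.invariant-single G s w I w∈T one noW₂

invariant-run : ∀ {n} (G : Graph n) (a : Fin n) {s} → Run G a s → Invariant G s
invariant-run G a start              = invariant-initial G a
invariant-run G a (step u run _ can) = invariant-step G (invariant-run G a run) can

lemma2 : ∀ {n} (G : Graph n) (a : Fin n) → Connected G → 2 ≤ degree G a
    → (s : State n) → Execution G a s
    → ∀ u v v' → adj G u v ≡ true → adj G u v' ≡ true
    → rank s u < rank s v → rank s u < rank s v' → v ≡ v'
lemma2 G a _ _ s (run , spanning) u v v' uv uv' rv rv' =
  rising-unique (invariant-run G a run) u (spanning u) uv uv' (rising rv) (rising rv')
  where
  rising : ∀ {x} → rank s u < rank s x → Rising s u x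
  rising {x} r rewrite spanning x = r
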